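{- Let $K$ be a field and $q\in K^\times$ with $q^N\neq1$ for all integers $N\geq1$. Let $x,y\in K^\times$ with $x\trianglelefteq y$, and let $u_1,\dots,u_k,v_1,\dots,v_k\in K^\times$ be such that no $t$ with $x\trianglelefteq t\trianglelefteq y$ lies in $\{u_1,\dots,u_k,v_1,\dots,v_k\}$. Then \[ I_q(x;[u_1,v_1],\dots,[u_k,v_k];y)=I_q\!\left(x;\left[\tfrac{xy}{v_k},\tfrac{xy}{u_k}\right],\dots,\left[\tfrac{xy}{v_1},\tfrac{xy}{u_1}\right];y\right). \]
   Context: Define a partial order on $K^\times$ by $x\trianglelefteq y$ iff $y/x\in\{q^{ -n}\mid n\in\mathbb{Z}_{\geq0}\}$. For $x\trianglelefteq y$ and $u_j,v_j\in K$ such that no $t$ with $x\trianglelefteq t\trianglelefteq y$ equals any $u_j$ or $v_j$, define \[ I_q(x;[u_1,v_1],\dots,[u_k,v_k];y):=\sum_{x\trianglelefteq t_1\trianglelefteq\cdots\trianglelefteq t_k\trianglelefteq y}\prod_{j=1}^k\left(\frac{t_j}{t_j-u_j}-\frac{t_j}{t_j-v_j}\right). \] -}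

module Defs where

open import Level using (Level; _⊔_) renaming (suc to lsuc)
open import Algebra.Bundles using (CommutativeRing)
open import Data.Nat using (ℕ; zero; suc) renaming (_+_ to _+ℕ_; _∸_ to _∸ℕ_)
open import Data.Fin using (Fin; zero; suc)
open import Data.Product using (Σ; _×_; _,_)
open import Relation.Nullary using (¬_)

-- The inverse is a total
-- function (its value at 0 is irrelevant and never used in the statement).
record Field (c ℓ : Level) : Set (lsuc (c ⊔ ℓ)) where
  field
    commutativeRing : CommutativeRing c ℓ
  open CommutativeRing commutativeRing public
  field
    _⁻¹       : Carrier → Carrier
    ⁻¹-cong   : ∀ {x y} → x ≈ y → x ⁻¹ ≈ y ⁻¹
    ⁻¹-inverse : ∀ x → ¬ (x ≈ 0#) → x * (x ⁻¹) ≈ 1#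
    0≉1       : ¬ (0# ≈ 1#)

module FieldDefs {c ℓ : Level} (F : Field c ℓ) where
  open Field F public using (Carrier; _≈_; _+_; _*_; -_; 0#; 1#; _⁻¹)

  infixl 6 _−_
  infixl 7 _÷_
  _−_ : Carrier → Carrier → Carrier
  a − b = a + (- b)

  _÷_ : Carrier → Carrier → Carrier
  a ÷ b = a * (b ⁻¹)

  pow : Carrier → ℕ → Carrier
  pow a zero    = 1#
  pow a (suc n) = a * pow a n

  _⊴[_]_ : Carrier → Carrier → Carrier → Set ℓ
  x ⊴[ q ] y = Σ ℕ (λ n → y ÷ x ≈ pow (q ⁻¹) n)

  sumN : ℕ → (ℕ → Carrier) → Carrier
  sumN zero    g = 0#
  sumN (suc n) g = sumN n g + g n

  -- chain sum over lo ≤ a₁ ≤ a₂ ≤ ⋯ ≤ a_k ≤ m of ∏_j f j a_j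
  chainSum : (k : ℕ) → ℕ → ℕ → (Fin k → ℕ → Carrier) → Carrier
  chainSum zero    lo m f = 1#
  chainSum (suc k) lo m f =
    sumN (suc m ∸ℕ lo) (λ i → f zero (lo +ℕ i) * chainSum k (lo +ℕ i) m (λ j → f (suc j)))

  ω : Carrier → Carrier → Carrier → Carrier
  ω t u v = (t ÷ (t − u)) − (t ÷ (t − v))

  -- The points t with x ⊴ t ⊴ y are
  -- t = x·q^{-a}, 0 ≤ a ≤ n, where y/x = q^{-n} (n is the witness of x ⊴ y,
  -- unique since q is not a root of unity); a chain x ⊴ t₁ ⊴ ⋯ ⊴ t_k ⊴ y
  -- corresponds to 0 ≤ a₁ ≤ ⋯ ≤ a_k ≤ n.
  Iq : (q x : Carrier) (k : ℕ) (u v : Fin k → Carrier) (y : Carrier) →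
       x ⊴[ q ] y → Carrier
  Iq q x k u v y (n , _) =
    chainSum k 0 n (λ j a → ω (x * pow (q ⁻¹) a) (u j) (v j))

-- The points between x and y are t_a = x q^{-a}, 0 ≤ a ≤ n, and t ↦ xy/t maps t_a to t_{n-a}.
-- Reindexing a chain 0 ≤ a₁ ≤ ⋯ ≤ a_k ≤ n by a_j ↦ n − a_{k+1−j} gives again such a chain, and
-- termwise, for s t = xy, one has s/(s − xy/v) = 1 − t/(t − v), whence ω(s; xy/v, xy/u) = ω(t; u, v).
-- The reindexing of the chain sum goes by induction on k: peeling off the last summation variable
-- instead of the first amounts to exchanging the order of summation over a triangle.
module Submission where

open import Defs
open import Level using (Level)
open import Data.Nat using (ℕ; zero; suc; _≤_; _<_; s≤s; z≤n; _≤?_) renaming (_+_ to _+ℕ_; _∸_ to _∸ℕ_)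
import Data.Nat.Properties as ℕ
open import Data.Fin using (Fin; zero; suc; opposite; inject₁; fromℕ)
open import Data.Fin.Properties using (opposite-involutive)
open import Data.Product using (_×_; _,_; proj₁; proj₂)
open import Function using (_∘_)
open import Relation.Nullary using (¬_; yes; no)
import Relation.Binary.PropositionalEquality as ≡
import Algebra.Properties.Ring as RingProperties
import Algebra.Properties.CommutativeSemigroup as CommutativeSemigroupProperties

i<n∸lo⇒lo+i<n : ∀ lo {i} n → i < n ∸ℕ lo → lo +ℕ i < n
i<n∸lo⇒lo+i<n zero    n       i<n    = i<n
i<n∸lo⇒lo+i<n (suc lo) zero    ()
i<n∸lo⇒lo+i<n (suc lo) (suc n) i<n∸lo = s≤s (i<n∸lo⇒lo+i<n lo n i<n∸lo)

opposite-inject₁ : ∀ {k} (j : Fin k) → opposite (inject₁ j) ≡.≡ suc (opposite j)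
opposite-inject₁ zero    = ≡.refl
opposite-inject₁ (suc j) = ≡.cong inject₁ (opposite-inject₁ j)

[lo+d+r]∸lo≡r+d : ∀ lo d r → lo +ℕ d +ℕ r ∸ℕ lo ≡.≡ r +ℕ d
[lo+d+r]∸lo≡r+d lo d r = begin
  lo +ℕ d +ℕ r ∸ℕ lo    ≡⟨ ≡.cong (_∸ℕ lo) (ℕ.+-assoc lo d r) ⟩
  lo +ℕ (d +ℕ r) ∸ℕ lo  ≡⟨ ℕ.m+n∸m≡n lo (d +ℕ r) ⟩
  d +ℕ r                ≡⟨ ℕ.+-comm d r ⟩
  r +ℕ d                ∎
  where open ≡.≡-Reasoning

[lo+d+r]∸[lo+i]≡r+[d∸i] : ∀ lo {d} r {i} → i ≤ d → lo +ℕ d +ℕ r ∸ℕ (lo +ℕ i) ≡.≡ r +ℕ (d ∸ℕ i)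
[lo+d+r]∸[lo+i]≡r+[d∸i] lo {d} r {i} i≤d = begin
  lo +ℕ d +ℕ r ∸ℕ (lo +ℕ i)    ≡⟨ ≡.cong (_∸ℕ (lo +ℕ i)) (ℕ.+-assoc lo d r) ⟩
  lo +ℕ (d +ℕ r) ∸ℕ (lo +ℕ i)  ≡⟨ ℕ.[m+n]∸[m+o]≡n∸o lo (d +ℕ r) i ⟩
  d +ℕ r ∸ℕ i                  ≡⟨ ℕ.+-∸-comm r i≤d ⟩
  d ∸ℕ i +ℕ r                  ≡⟨ ℕ.+-comm (d ∸ℕ i) r ⟩
  r +ℕ (d ∸ℕ i)                ∎
  where open ≡.≡-Reasoning

module _ {c ℓ : Level} (F : Field c ℓ) where
  open Field F hiding (zero)
  open FieldDefs F using (_−_; _÷_; pow; _⊴[_]_; sumN; chainSum; ω)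
  open RingProperties ring using (x[y-z]≈xy-xz; -‿distribˡ-*; ⁻¹-anti-homo‿-; x∙y⁻¹≈ε⇒x≈y)
  open CommutativeSemigroupProperties *-commutativeSemigroup using (x∙yz≈y∙xz; xy∙z≈xz∙y; x∙yz≈z∙xy)
  open CommutativeSemigroupProperties +-commutativeSemigroup using (interchange)
  open import Relation.Binary.Reasoning.Setoid setoid

  x≈z*y⇒x÷y≈z : ∀ {x y z} → ¬ y ≈ 0# → x ≈ z * y → x ÷ y ≈ z
  x≈z*y⇒x÷y≈z {x} {y} {z} y≉0 x≈zy = begin
    x * y ⁻¹        ≈⟨ *-congʳ x≈zy ⟩
    z * y * y ⁻¹    ≈⟨ *-assoc z y (y ⁻¹) ⟩
    z * (y * y ⁻¹)  ≈⟨ *-congˡ (⁻¹-inverse y y≉0) ⟩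
    z * 1#          ≈⟨ *-identityʳ z ⟩
    z               ∎

  y*[x÷y]≈x : ∀ {x y} → ¬ y ≈ 0# → y * (x ÷ y) ≈ x
  y*[x÷y]≈x {x} {y} y≉0 = begin
    y * (x * y ⁻¹)  ≈⟨ x∙yz≈y∙xz y x (y ⁻¹) ⟩
    x * (y * y ⁻¹)  ≈⟨ *-congˡ (⁻¹-inverse y y≉0) ⟩
    x * 1#          ≈⟨ *-identityʳ x ⟩
    x               ∎

  x*y≉0 : ∀ {x y} → ¬ x ≈ 0# → ¬ y ≈ 0# → ¬ x * y ≈ 0#
  x*y≉0 {x} {y} x≉0 y≉0 xy≈0 = y≉0 (begin
    y            ≈⟨ x≈z*y⇒x÷y≈z x≉0 (*-comm x y) ⟨
    x * y ÷ x    ≈⟨ *-congʳ xy≈0 ⟩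
    0# * x ⁻¹    ≈⟨ zeroˡ (x ⁻¹) ⟩
    0#           ∎)

  x*w≈z*y⇒x÷y≈z÷w : ∀ {x y z w} → ¬ y ≈ 0# → ¬ w ≈ 0# → x * w ≈ z * y → x ÷ y ≈ z ÷ w
  x*w≈z*y⇒x÷y≈z÷w {x} {y} {z} {w} y≉0 w≉0 xw≈zy = x≈z*y⇒x÷y≈z y≉0 (begin
    x                ≈⟨ x≈z*y⇒x÷y≈z w≉0 refl ⟨
    x * w * w ⁻¹     ≈⟨ *-congʳ xw≈zy ⟩
    z * y * w ⁻¹     ≈⟨ xy∙z≈xz∙y z y (w ⁻¹) ⟩
    z * w ⁻¹ * y     ∎)

  x+y≈z+w⇒x-z≈w-y : ∀ {x y z w} → x + y ≈ z + w → x − z ≈ w − y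
  x+y≈z+w⇒x-z≈w-y {x} {y} {z} {w} x+y≈z+w = begin
    x − z                  ≈⟨ +-identityʳ (x − z) ⟨
    x − z + 0#             ≈⟨ +-congˡ (-‿inverseʳ y) ⟨
    (x − z) + (y − y)      ≈⟨ interchange x (- z) y (- y) ⟩
    (x + y) + (- z − y)    ≈⟨ +-congʳ x+y≈z+w ⟩
    (z + w) + (- z − y)    ≈⟨ interchange z w (- z) (- y) ⟩
    (z − z) + (w − y)      ≈⟨ +-congʳ (-‿inverseʳ z) ⟩
    0# + (w − y)           ≈⟨ +-identityˡ (w − y) ⟩
    w − y                  ∎

  s÷[s-w÷v]+t÷[t-v]≈1 : ∀ {s t v w} → s * t ≈ w → ¬ s ≈ 0# → ¬ v ≈ 0# → ¬ t ≈ v →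
                        s ÷ (s − w ÷ v) + t ÷ (t − v) ≈ 1#
  s÷[s-w÷v]+t÷[t-v]≈1 {s} {t} {v} {w} st≈w s≉0 v≉0 t≉v = begin
    s ÷ (s − w ÷ v) + t ÷ (t − v)  ≈⟨ +-congʳ (x*w≈z*y⇒x÷y≈z÷w s-w÷v≉0 t-v≉0 cross) ⟩
    - v ÷ (t − v) + t ÷ (t − v)    ≈⟨ distribʳ ((t − v) ⁻¹) (- v) t ⟨
    (- v + t) ÷ (t − v)            ≈⟨ *-congʳ (+-comm (- v) t) ⟩
    (t − v) ÷ (t − v)              ≈⟨ ⁻¹-inverse (t − v) t-v≉0 ⟩
    1#                             ∎
    where
    t-v≉0 : ¬ t − v ≈ 0#
    t-v≉0 = t≉v ∘ x∙y⁻¹≈ε⇒x≈y t v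
    cross : s * (t − v) ≈ - v * (s − w ÷ v)
    cross = begin
      s * (t − v)               ≈⟨ x[y-z]≈xy-xz s t v ⟩
      s * t − s * v             ≈⟨ +-cong st≈w (-‿cong (*-comm s v)) ⟩
      w − v * s                 ≈⟨ +-congʳ (y*[x÷y]≈x v≉0) ⟨
      v * (w ÷ v) − v * s       ≈⟨ ⁻¹-anti-homo‿- (v * s) (v * (w ÷ v)) ⟨
      - (v * s − v * (w ÷ v))   ≈⟨ -‿cong (x[y-z]≈xy-xz v s (w ÷ v)) ⟨
      - (v * (s − w ÷ v))       ≈⟨ -‿distribˡ-* v (s − w ÷ v) ⟩
      - v * (s − w ÷ v)         ∎
    s-w÷v≉0 : ¬ s − w ÷ v ≈ 0#
    s-w÷v≉0 s-w÷v≈0 = x*y≉0 s≉0 t-v≉0 (begin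
      s * (t − v)          ≈⟨ cross ⟩
      - v * (s − w ÷ v)    ≈⟨ *-congˡ s-w÷v≈0 ⟩
      - v * 0#             ≈⟨ zeroʳ (- v) ⟩
      0#                   ∎)

  ω-reflect : ∀ {s t u v w} → s * t ≈ w → ¬ s ≈ 0# → ¬ u ≈ 0# → ¬ v ≈ 0# → ¬ t ≈ u → ¬ t ≈ v →
              ω s (w ÷ v) (w ÷ u) ≈ ω t u v
  ω-reflect {s} {t} {u} {v} {w} st≈w s≉0 u≉0 v≉0 t≉u t≉v = x+y≈z+w⇒x-z≈w-y (begin
    s ÷ (s − w ÷ v) + t ÷ (t − v)  ≈⟨ s÷[s-w÷v]+t÷[t-v]≈1 st≈w s≉0 v≉0 t≉v ⟩
    1#                             ≈⟨ s÷[s-w÷v]+t÷[t-v]≈1 st≈w s≉0 u≉0 t≉u ⟨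
    s ÷ (s − w ÷ u) + t ÷ (t − u)  ∎)

  pow-+ : ∀ x m n → pow x (m +ℕ n) ≈ pow x m * pow x n
  pow-+ x zero    n = sym (*-identityˡ (pow x n))
  pow-+ x (suc m) n = trans (*-congˡ (pow-+ x m n)) (sym (*-assoc x (pow x m) (pow x n)))

  pow-≉0 : ∀ {x} → ¬ x ≈ 0# → ∀ n → ¬ pow x n ≈ 0#
  pow-≉0 x≉0 zero    1≈0 = 0≉1 (sym 1≈0)
  pow-≉0 x≉0 (suc n)     = x*y≉0 x≉0 (pow-≉0 x≉0 n)

  x⁻¹≉0 : ∀ {x} → ¬ x ≈ 0# → ¬ x ⁻¹ ≈ 0#
  x⁻¹≉0 {x} x≉0 x⁻¹≈0 = 0≉1 (begin
    0#          ≈⟨ zeroʳ x ⟨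
    x * 0#      ≈⟨ *-congˡ x⁻¹≈0 ⟨
    x * x ⁻¹    ≈⟨ ⁻¹-inverse x x≉0 ⟩
    1#          ∎)

  module Progression {q x y : Carrier} {n : ℕ} (q≉0 : ¬ q ≈ 0#) (x≉0 : ¬ x ≈ 0#)
                     (y÷x≈pⁿ : y ÷ x ≈ pow (q ⁻¹) n) (b c : ℕ) (b+c≡n : b +ℕ c ≡.≡ n) where

    y≈x*pᵇ*pᶜ : y ≈ x * (pow (q ⁻¹) b * pow (q ⁻¹) c)
    y≈x*pᵇ*pᶜ = begin
      y                                  ≈⟨ y*[x÷y]≈x x≉0 ⟨
      x * (y ÷ x)                        ≈⟨ *-congˡ y÷x≈pⁿ ⟩
      x * pow (q ⁻¹) n                   ≡⟨ ≡.cong (λ m → x * pow (q ⁻¹) m) b+c≡n ⟨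
      x * pow (q ⁻¹) (b +ℕ c)            ≈⟨ *-congˡ (pow-+ (q ⁻¹) b c) ⟩
      x * (pow (q ⁻¹) b * pow (q ⁻¹) c)  ∎

    x⊴x*pᵇ : x ⊴[ q ] (x * pow (q ⁻¹) b)
    x⊴x*pᵇ = b , x≈z*y⇒x÷y≈z x≉0 (*-comm x (pow (q ⁻¹) b))

    x*pᵇ⊴y : (x * pow (q ⁻¹) b) ⊴[ q ] y
    x*pᵇ⊴y = c , x≈z*y⇒x÷y≈z (x*y≉0 x≉0 (pow-≉0 (x⁻¹≉0 q≉0) b))
      (trans y≈x*pᵇ*pᶜ (x∙yz≈z∙xy x (pow (q ⁻¹) b) (pow (q ⁻¹) c)))

    x*pᵇ*x*pᶜ≈x*y : x * pow (q ⁻¹) b * (x * pow (q ⁻¹) c) ≈ x * y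
    x*pᵇ*x*pᶜ≈x*y = begin
      x * pᵇ * (x * pᶜ)    ≈⟨ *-assoc x pᵇ (x * pᶜ) ⟩
      x * (pᵇ * (x * pᶜ))  ≈⟨ *-congˡ (x∙yz≈y∙xz pᵇ x pᶜ) ⟩
      x * (x * (pᵇ * pᶜ))  ≈⟨ *-congˡ y≈x*pᵇ*pᶜ ⟨
      x * y                ∎
      where
      pᵇ = pow (q ⁻¹) b
      pᶜ = pow (q ⁻¹) c

  sumN-cong : ∀ L {g h : ℕ → Carrier} → (∀ i → i < L → g i ≈ h i) → sumN L g ≈ sumN L h
  sumN-cong zero    g≈h = refl
  sumN-cong (suc L) g≈h = +-cong (sumN-cong L (λ i i<L → g≈h i (ℕ.m<n⇒m<1+n i<L))) (g≈h L ℕ.≤-refl)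

  sumN-distrib-+ : ∀ L (g h : ℕ → Carrier) → sumN L (λ i → g i + h i) ≈ sumN L g + sumN L h
  sumN-distrib-+ zero    g h = sym (+-identityˡ 0#)
  sumN-distrib-+ (suc L) g h =
    trans (+-congʳ (sumN-distrib-+ L g h)) (interchange (sumN L g) (sumN L h) (g L) (h L))

  *-distribˡ-sumN : ∀ L x (g : ℕ → Carrier) → x * sumN L g ≈ sumN L (λ i → x * g i)
  *-distribˡ-sumN zero    x g = zeroʳ x
  *-distribˡ-sumN (suc L) x g = trans (distribˡ x (sumN L g) (g L)) (+-congʳ (*-distribˡ-sumN L x g))

  sumN-cons : ∀ L (g : ℕ → Carrier) → sumN (suc L) g ≈ g 0 + sumN L (g ∘ suc)
  sumN-cons zero    g = +-comm 0# (g 0)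
  sumN-cons (suc L) g = trans (+-congʳ (sumN-cons L g)) (+-assoc (g 0) (sumN L (g ∘ suc)) (g (suc L)))

  sumN-reverse : ∀ L (g : ℕ → Carrier) → sumN L g ≈ sumN L (λ i → g (L ∸ℕ suc i))
  sumN-reverse zero    g = refl
  sumN-reverse (suc L) g = begin
    sumN L g + g L                             ≈⟨ +-comm (sumN L g) (g L) ⟩
    g L + sumN L g                             ≈⟨ +-congˡ (sumN-reverse L g) ⟩
    g L + sumN L (λ i → g (L ∸ℕ suc i))        ≈⟨ sumN-cons L (λ i → g (suc L ∸ℕ suc i)) ⟨
    sumN (suc L) (λ i → g (suc L ∸ℕ suc i))    ∎

  -- Shaped so that chainSum (suc k) lo m f unfolds to
  -- ∑[ lo ≤ a ≤ m ] (f zero a * chainSum k a m (f ∘ suc)).  Because it unfolds, unification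
  -- cannot recover lo, m or the summand, which is why these are often passed explicitly below.
  intervalSum : ℕ → ℕ → (ℕ → Carrier) → Carrier
  intervalSum lo m h = sumN (suc m ∸ℕ lo) (λ i → h (lo +ℕ i))

  syntax intervalSum lo m (λ a → e) = ∑[ lo ≤ a ≤ m ] e

  ∑-cong : ∀ {lo m} {g h : ℕ → Carrier} → (∀ a → lo ≤ a → a ≤ m → g a ≈ h a) →
           ∑[ lo ≤ a ≤ m ] g a ≈ ∑[ lo ≤ a ≤ m ] h a
  ∑-cong {lo} {m} g≈h = sumN-cong (suc m ∸ℕ lo) (λ i i<L →
    g≈h (lo +ℕ i) (ℕ.m≤m+n lo i) (ℕ.≤-pred (i<n∸lo⇒lo+i<n lo (suc m) i<L)))

  *-distribˡ-∑ : ∀ lo m x (h : ℕ → Carrier) → x * ∑[ lo ≤ a ≤ m ] h a ≈ ∑[ lo ≤ a ≤ m ] (x * h a)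
  *-distribˡ-∑ lo m x h = *-distribˡ-sumN (suc m ∸ℕ lo) x (λ i → h (lo +ℕ i))

  ∑-empty : ∀ {lo m} (h : ℕ → Carrier) → m < lo → ∑[ lo ≤ a ≤ m ] h a ≈ 0#
  ∑-empty h m<lo rewrite ℕ.m≤n⇒m∸n≡0 m<lo = refl

  ∑-single : ∀ m (h : ℕ → Carrier) → ∑[ m ≤ a ≤ m ] h a ≈ h m
  ∑-single m h rewrite ℕ.m+n∸n≡m 1 m | ℕ.+-identityʳ m = +-identityˡ (h m)

  ∑-snoc : ∀ {lo m} (h : ℕ → Carrier) → lo ≤ suc m →
           ∑[ lo ≤ a ≤ suc m ] h a ≈ ∑[ lo ≤ a ≤ m ] h a + h (suc m)
  ∑-snoc {lo} {m} h lo≤1+m rewrite ℕ.+-∸-assoc 1 lo≤1+m =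
    +-congˡ (reflexive (≡.cong h (ℕ.m+[n∸m]≡n lo≤1+m)))

  ∑-length : ∀ lo d (h : ℕ → Carrier) → ∑[ lo ≤ a ≤ lo +ℕ d ] h a ≈ sumN (suc d) (λ i → h (lo +ℕ i))
  ∑-length lo d h rewrite ≡.sym (ℕ.+-suc lo d) | ℕ.m+n∸m≡n lo (suc d) = refl

  ∑-reflect : ∀ {lo m n} (h : ℕ → Carrier) → lo ≤ m → m ≤ n →
              ∑[ n ∸ℕ m ≤ b ≤ n ∸ℕ lo ] h b ≈ ∑[ lo ≤ a ≤ m ] h (n ∸ℕ a)
  ∑-reflect {lo} h lo≤m m≤n with ℕ.m≤n⇒∃[o]m+o≡n lo≤m | ℕ.m≤n⇒∃[o]m+o≡n m≤n
  ... | d , ≡.refl | r , ≡.refl = begin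
    ∑[ n ∸ℕ (lo +ℕ d) ≤ b ≤ n ∸ℕ lo ] h b
      ≡⟨ ≡.cong₂ (λ lo′ m′ → ∑[ lo′ ≤ b ≤ m′ ] h b) (ℕ.m+n∸m≡n (lo +ℕ d) r) ([lo+d+r]∸lo≡r+d lo d r) ⟩
    ∑[ r ≤ b ≤ r +ℕ d ] h b                 ≈⟨ ∑-length r d h ⟩
    sumN (suc d) (λ i → h (r +ℕ i))         ≈⟨ sumN-reverse (suc d) (λ i → h (r +ℕ i)) ⟩
    sumN (suc d) (λ i → h (r +ℕ (d ∸ℕ i)))
      ≈⟨ sumN-cong (suc d) (λ i i<1+d → reflexive (≡.cong h
           (≡.sym ([lo+d+r]∸[lo+i]≡r+[d∸i] lo r (ℕ.≤-pred i<1+d))))) ⟩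
    sumN (suc d) (λ i → h (n ∸ℕ (lo +ℕ i))) ≈⟨ ∑-length lo d (λ a → h (n ∸ℕ a)) ⟨
    ∑[ lo ≤ a ≤ lo +ℕ d ] h (n ∸ℕ a)        ∎
    where n = lo +ℕ d +ℕ r

  ∑-swap : ∀ lo m (H : ℕ → ℕ → Carrier) →
           ∑[ lo ≤ i ≤ m ] ∑[ i ≤ a ≤ m ] H i a ≈ ∑[ lo ≤ a ≤ m ] ∑[ lo ≤ i ≤ a ] H i a
  ∑-swap lo m H with lo ≤? m
  ... | no lo≰m = trans (∑-empty (λ i → ∑[ i ≤ a ≤ m ] H i a) m<lo)
                         (sym (∑-empty (λ a → ∑[ lo ≤ i ≤ a ] H i a) m<lo))
    where m<lo = ℕ.≰⇒> lo≰m
  ∑-swap lo zero    H | yes z≤n     = refl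
  ∑-swap lo (suc m) H | yes lo≤1+m = begin
    ∑[ lo ≤ i ≤ suc m ] ∑[ i ≤ a ≤ suc m ] H i a
      ≈⟨ ∑-snoc (λ i → ∑[ i ≤ a ≤ suc m ] H i a) lo≤1+m ⟩
    ∑[ lo ≤ i ≤ m ] ∑[ i ≤ a ≤ suc m ] H i a + ∑[ suc m ≤ a ≤ suc m ] H (suc m) a
      ≈⟨ +-cong (∑-cong {lo} {m} (λ i _ i≤m → ∑-snoc (H i) (ℕ.m≤n⇒m≤1+n i≤m)))
                (∑-single (suc m) (H (suc m))) ⟩
    ∑[ lo ≤ i ≤ m ] (∑[ i ≤ a ≤ m ] H i a + H i (suc m)) + H (suc m) (suc m)
      ≈⟨ +-congʳ (sumN-distrib-+ (suc m ∸ℕ lo) _ _) ⟩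
    ∑[ lo ≤ i ≤ m ] ∑[ i ≤ a ≤ m ] H i a + ∑[ lo ≤ i ≤ m ] H i (suc m) + H (suc m) (suc m)
      ≈⟨ +-congʳ (+-congʳ (∑-swap lo m H)) ⟩
    ∑[ lo ≤ a ≤ m ] ∑[ lo ≤ i ≤ a ] H i a + ∑[ lo ≤ i ≤ m ] H i (suc m) + H (suc m) (suc m)
      ≈⟨ +-assoc _ _ _ ⟩
    ∑[ lo ≤ a ≤ m ] ∑[ lo ≤ i ≤ a ] H i a + (∑[ lo ≤ i ≤ m ] H i (suc m) + H (suc m) (suc m))
      ≈⟨ +-congˡ (∑-snoc (λ i → H i (suc m)) lo≤1+m) ⟨
    ∑[ lo ≤ a ≤ m ] ∑[ lo ≤ i ≤ a ] H i a + ∑[ lo ≤ i ≤ suc m ] H i (suc m)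
      ≈⟨ ∑-snoc (λ a → ∑[ lo ≤ i ≤ a ] H i a) lo≤1+m ⟨
    ∑[ lo ≤ a ≤ suc m ] ∑[ lo ≤ i ≤ a ] H i a  ∎

  chainSum-cong : ∀ k {lo m} {f g : Fin k → ℕ → Carrier} →
                  (∀ j a → lo ≤ a → a ≤ m → f j a ≈ g j a) → chainSum k lo m f ≈ chainSum k lo m g
  chainSum-cong zero    f≈g = refl
  chainSum-cong (suc k) f≈g = ∑-cong (λ a lo≤a a≤m →
    *-cong (f≈g zero a lo≤a a≤m)
           (chainSum-cong k (λ j b a≤b b≤m → f≈g (suc j) b (ℕ.≤-trans lo≤a a≤b) b≤m)))

  chainSum-last : ∀ k lo m (f : Fin (suc k) → ℕ → Carrier) →
    chainSum (suc k) lo m f ≈ ∑[ lo ≤ a ≤ m ] (f (fromℕ k) a * chainSum k lo a (f ∘ inject₁))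
  chainSum-last zero    lo m f = refl
  chainSum-last (suc k) lo m f = begin
    ∑[ lo ≤ i ≤ m ] (f zero i * chainSum (suc k) i m (f ∘ suc))
      ≈⟨ ∑-cong {lo} {m} (λ i _ _ → *-congˡ {f zero i} (chainSum-last k i m (f ∘ suc))) ⟩
    ∑[ lo ≤ i ≤ m ] (f zero i * ∑[ i ≤ a ≤ m ] (fₖ a * C i a))
      ≈⟨ ∑-cong {lo} {m} (λ i _ _ → *-distribˡ-∑ i m (f zero i) (λ a → fₖ a * C i a)) ⟩
    ∑[ lo ≤ i ≤ m ] ∑[ i ≤ a ≤ m ] (f zero i * (fₖ a * C i a))
      ≈⟨ ∑-swap lo m (λ i a → f zero i * (fₖ a * C i a)) ⟩
    ∑[ lo ≤ a ≤ m ] ∑[ lo ≤ i ≤ a ] (f zero i * (fₖ a * C i a))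
      ≈⟨ ∑-cong {lo} {m} (λ a _ _ → ∑-cong {lo} {a} (λ i _ _ → x∙yz≈y∙xz (f zero i) (fₖ a) (C i a))) ⟩
    ∑[ lo ≤ a ≤ m ] ∑[ lo ≤ i ≤ a ] (fₖ a * (f zero i * C i a))
      ≈⟨ ∑-cong {lo} {m} (λ a _ _ → *-distribˡ-∑ lo a (fₖ a) (λ i → f zero i * C i a)) ⟨
    ∑[ lo ≤ a ≤ m ] (fₖ a * ∑[ lo ≤ i ≤ a ] (f zero i * C i a)) ∎
    where
    fₖ : ℕ → Carrier
    fₖ = f (fromℕ (suc k))
    C : ℕ → ℕ → Carrier
    C i a = chainSum k i a (f ∘ suc ∘ inject₁)

  mirror : ∀ {k} → ℕ → (Fin k → ℕ → Carrier) → Fin k → ℕ → Carrier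
  mirror n f j a = f (opposite j) (n ∸ℕ a)

  chainSum-mirror′ : ∀ n k {lo m} (f : Fin k → ℕ → Carrier) → lo ≤ m → m ≤ n →
                     chainSum k lo m f ≈ chainSum k (n ∸ℕ m) (n ∸ℕ lo) (mirror n f)
  chainSum-mirror′ n zero    f lo≤m m≤n = refl
  chainSum-mirror′ n (suc k) {lo} {m} f lo≤m m≤n = begin
    ∑[ lo ≤ a ≤ m ] (f zero a * chainSum k a m (f ∘ suc))
      ≈⟨ ∑-cong {lo} {m} (λ a _ a≤m → *-congˡ {f zero a} (chainSum-mirror′ n k (f ∘ suc) a≤m m≤n)) ⟩
    ∑[ lo ≤ a ≤ m ] (f zero a * chainSum k (n ∸ℕ m) (n ∸ℕ a) (mirror n (f ∘ suc)))
      ≈⟨ ∑-cong {lo} {m} (λ a _ a≤m → *-cong (f₀≈gₖ a≤m) (chainSum-cong k {n ∸ℕ m} {n ∸ℕ a} (λ j b _ _ →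
           reflexive (≡.cong (λ i → f i (n ∸ℕ b)) (≡.sym (opposite-inject₁ j)))))) ⟩
    ∑[ lo ≤ a ≤ m ] (g (fromℕ k) (n ∸ℕ a) * chainSum k (n ∸ℕ m) (n ∸ℕ a) (g ∘ inject₁))
      ≈⟨ ∑-reflect (λ b → g (fromℕ k) b * chainSum k (n ∸ℕ m) b (g ∘ inject₁)) lo≤m m≤n ⟨
    ∑[ n ∸ℕ m ≤ b ≤ n ∸ℕ lo ] (g (fromℕ k) b * chainSum k (n ∸ℕ m) b (g ∘ inject₁))
      ≈⟨ chainSum-last k (n ∸ℕ m) (n ∸ℕ lo) g ⟨
    chainSum (suc k) (n ∸ℕ m) (n ∸ℕ lo) g ∎
    where
    g : Fin (suc k) → ℕ → Carrier
    g = mirror n f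
    f₀≈gₖ : ∀ {a} → a ≤ m → f zero a ≈ g (fromℕ k) (n ∸ℕ a)
    f₀≈gₖ a≤m = reflexive (≡.sym (≡.cong₂ f (opposite-involutive zero)
                                            (ℕ.m∸[m∸n]≡n (ℕ.≤-trans a≤m m≤n))))

  chainSum-mirror : ∀ n k (f : Fin k → ℕ → Carrier) → chainSum k 0 n f ≈ chainSum k 0 n (mirror n f)
  chainSum-mirror n k f = begin
    chainSum k 0 n f                       ≈⟨ chainSum-mirror′ n k f z≤n ℕ.≤-refl ⟩
    chainSum k (n ∸ℕ n) n (mirror n f)     ≡⟨ ≡.cong (λ lo → chainSum k lo n (mirror n f)) (ℕ.n∸n≡0 n) ⟩
    chainSum k 0 n (mirror n f)            ∎

lemma4p1 : {c ℓ : Level} (F : Field c ℓ) →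
    let open FieldDefs F in
    (q : Carrier) → ¬ (q ≈ 0#) → ((N : ℕ) → ¬ (pow q (suc N) ≈ 1#)) →
    (x y : Carrier) → ¬ (x ≈ 0#) → ¬ (y ≈ 0#) →
    (x⊴y : x ⊴[ q ] y) →
    (k : ℕ) (u v : Fin k → Carrier) →
    ((j : Fin k) → ¬ (u j ≈ 0#) × ¬ (v j ≈ 0#)) →
    ((t : Carrier) → x ⊴[ q ] t → t ⊴[ q ] y →
      (j : Fin k) → ¬ (t ≈ u j) × ¬ (t ≈ v j)) →
    Iq q x k u v y x⊴y
      ≈ Iq q x k (λ j → (x * y) ÷ v (opposite j)) (λ j → (x * y) ÷ u (opposite j)) y x⊴y
-- That q is not a root of unity only makes the exponent n of x ⊴ y unique; Iq uses the given
-- witness, so the identity holds without it.  Likewise y ≉ 0 already follows from x ⊴ y.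
lemma4p1 F q q≉0 _ x y x≉0 _ (n , y÷x≈pⁿ) k u v u,v≉0 avoid = begin
  chainSum k 0 n f                ≈⟨ chainSum-mirror F n k f ⟩
  chainSum k 0 n (mirror F n f)   ≈⟨ chainSum-cong F k (λ j a _ a≤n → ω-mirror (opposite j) a≤n) ⟩
  chainSum k 0 n g                ∎
  where
  open Field F hiding (zero)
  open FieldDefs F using (_÷_; pow; ω; chainSum)
  open import Relation.Binary.Reasoning.Setoid setoid

  f g : Fin k → ℕ → Carrier
  f j a = ω (x * pow (q ⁻¹) a) (u j) (v j)
  g j a = ω (x * pow (q ⁻¹) a) ((x * y) ÷ v (opposite j)) ((x * y) ÷ u (opposite j))

  ω-mirror : ∀ i {a} → a ≤ n → ω (x * pow (q ⁻¹) (n ∸ℕ a)) (u i) (v i)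
                               ≈ ω (x * pow (q ⁻¹) a) ((x * y) ÷ v i) ((x * y) ÷ u i)
  ω-mirror i {a} a≤n = sym (ω-reflect F (trans (*-comm _ _) t.x*pᵇ*x*pᶜ≈x*y)
    (x*y≉0 F x≉0 (pow-≉0 F (x⁻¹≉0 F q≉0) a)) (proj₁ (u,v≉0 i)) (proj₂ (u,v≉0 i))
    (proj₁ (avoid _ t.x⊴x*pᵇ t.x*pᵇ⊴y i)) (proj₂ (avoid _ t.x⊴x*pᵇ t.x*pᵇ⊴y i)))
    where module t = Progression F q≉0 x≉0 y÷x≈pⁿ (n ∸ℕ a) a (ℕ.m∸n+n≡m a≤n)
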